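{- Let $\mathcal{S}$ be a strongly regular configuration with parameters $(v_k;\lambda,\mu)$, i.e. a symmetric $(v_k)$ configuration whose point graph is a strongly regular graph $SRG(v,k(k-1),\lambda,\mu)$. Then the line graph of $\mathcal{S}$ is also a strongly regular graph with parameters $SRG(v,k(k-1),\lambda,\mu)$.
   Context: A symmetric $(v_k)$ configuration is a finite incidence structure of $v$ points and $v$ lines such that every line is incident with exactly $k$ points, every point is incident with exactly $k$ lines, and two distinct points are incident with at most one common line (equivalently two distinct lines share at most one point); throughout $k\ge 3$. The point graph has the points as vertices, two distinct points adjacent iff they lie on a common line. The line graph (not in the graph-theoretic sense $L(G)$) has the lines as vertices, two distinct lines adjacent iff they share a point. A graph is $SRG(n,d,\lambda,\mu)$ if it has $n$ vertices, is $d$-regular, any two adjacent vertices have exactly $\lambda$ common neighbours and any two distinct non-adjacent vertices have exactly $\mu$ common neighbours. -}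

module Defs where

open import Data.Nat using (ℕ; zero; suc; _≤_; _*_; _∸_)
open import Data.Bool using (Bool; true; false; _∧_; not)
open import Data.Fin using (Fin; _≟_)
open import Relation.Nullary using (yes; no)
open import Data.Product using (_×_)
open import Relation.Binary.PropositionalEquality using (_≡_; _≢_)
open import Relation.Nullary using (¬_)

count : ∀ {n} → (Fin n → Bool) → ℕ
count {zero} f = 0
count {suc n} f with f Data.Fin.zero
... | true  = suc (count (λ i → f (Data.Fin.suc i)))
... | false = count (λ i → f (Data.Fin.suc i))

-- A symmetric (v_k) configuration: points Fin v, lines Fin v,
-- incidence I p L = true iff point p lies on line L.
record SymConfig (v k : ℕ) : Set where
  field
    I            : Fin v → Fin v → Bool
    line-size    : ∀ (L : Fin v) → count (λ p → I p L) ≡ k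
    point-degree : ∀ (p : Fin v) → count (λ L → I p L) ≡ k
    at-most-one  : ∀ (p q : Fin v) → p ≢ q → count (λ L → I p L ∧ I q L) ≤ 1

positive : ℕ → Bool
positive zero = false
positive (suc _) = true

module _ {v k : ℕ} (S : SymConfig v k) where
  open SymConfig S

  pointAdj : Fin v → Fin v → Bool
  pointAdj p q with p ≟ q
  ... | yes _ = false
  ... | no  _ = positive (count (λ L → I p L ∧ I q L))

  lineAdj : Fin v → Fin v → Bool
  lineAdj L M with L ≟ M
  ... | yes _ = false
  ... | no  _ = positive (count (λ p → I p L ∧ I p M))

record IsSRG (n : ℕ) (adj : Fin n → Fin n → Bool) (d lam mu : ℕ) : Set where
  field
    irrefl    : ∀ x → adj x x ≡ false
    symmetric : ∀ x y → adj x y ≡ adj y x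
    regular   : ∀ x → count (λ z → adj x z) ≡ d
    adjacent  : ∀ x y → adj x y ≡ true → count (λ z → adj x z ∧ adj y z) ≡ lam
    nonadj    : ∀ x y → x ≢ y → adj x y ≡ false → count (λ z → adj x z ∧ adj y z) ≡ mu

-- Let N be the point–line incidence matrix, A the adjacency matrix of the point graph and B that of
-- the line graph. The configuration axioms say N Nᵀ = A + kI and Nᵀ N = B + kI, whence N B = A N.
-- The point graph is SRG(v, d, λ, μ) exactly when E(A) = 0 for the quadratic
-- E(X) = X² + (μ − λ) X + (μ − d) I − μ J, and the intertwining gives N E(B) = E(A) N = 0.
-- Transposing, E(B) Nᵀ = 0, so E(B) B = E(B) (Nᵀ N − kI) = −k E(B). Both graphs have degree k² − k,
-- so E(B) has the same (zero) row sums as E(A), and its diagonal vanishes; hence the diagonal of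
-- E(B) E(B) vanishes too. E(B) being symmetric, each diagonal entry of E(B)² is a sum of squares of
-- entries of E(B), so E(B) = 0 and the line graph is SRG(v, d, λ, μ) as well.
module Submission where

open import Data.Bool using (Bool; true; false; _∧_; T)
import Data.Bool.Properties as Bool
open import Data.Fin using (Fin; zero; suc; _≟_)
open import Data.Fin.Properties using (suc-injective)
open import Data.Nat using (ℕ; zero; suc; _≤_; z≤n; s≤s)
import Data.Nat.Properties as ℕ
open import Data.Product using (_×_; _,_; proj₁; proj₂)
open import Data.Sum using (reduce)
open import Function using (_∘_)
open import Relation.Nullary using (Dec; yes; no; does; ¬_; contradiction)
open import Relation.Nullary.Decidable using (dec-true; dec-false)
open import Relation.Binary.PropositionalEquality

open import Defs

count-pos : ∀ {n} (f : Fin n → Bool) {i} → T (f i) → 1 ≤ count f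
count-pos f {zero} fi with f zero
... | true  = s≤s z≤n
count-pos f {suc i} fi with f zero
... | true  = s≤s z≤n
... | false = count-pos (f ∘ suc) fi

count-suc≤ : ∀ {n} (f : Fin (suc n) → Bool) → count (f ∘ suc) ≤ count f
count-suc≤ f with f zero
... | true  = ℕ.n≤1+n _
... | false = ℕ.≤-refl

count≡0 : ∀ {n} (f : Fin n → Bool) → (∀ i → ¬ T (f i)) → count f ≡ 0
count≡0 {zero}  f none = refl
count≡0 {suc n} f none with f zero | none zero
... | true  | ¬T = contradiction _ ¬T
... | false | _  = count≡0 (f ∘ suc) (none ∘ suc)

count≤1⇒unique : ∀ {n} (f : Fin n → Bool) → count f ≤ 1 → ∀ {i j} → T (f i) → T (f j) → i ≡ j
count≤1⇒unique f c {zero}  {zero}  _  _  = refl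
count≤1⇒unique f c {zero}  {suc j} fi fj = contradiction (ℕ.≤-trans (count≥2 f fi fj) c) λ { (s≤s ()) }
  where
  count≥2 : ∀ {n} (f : Fin (suc n) → Bool) {j} → T (f zero) → T (f (suc j)) → 2 ≤ count f
  count≥2 f f0 fj with f zero
  ... | true = s≤s (count-pos (f ∘ suc) fj)
count≤1⇒unique f c {suc i} {zero}  fi fj = sym (count≤1⇒unique f c fj fi)
count≤1⇒unique f c {suc i} {suc j} fi fj =
  cong suc (count≤1⇒unique (f ∘ suc) (ℕ.≤-trans (count-suc≤ f) c) fi fj)

unique⇒count≤1 : ∀ {n} (f : Fin n → Bool) → (∀ {i j} → T (f i) → T (f j) → i ≡ j) → count f ≤ 1
unique⇒count≤1 {zero}  f unique = z≤n
unique⇒count≤1 {suc n} f unique with f zero | unique {zero}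
... | true  | unique₀ = s≤s (ℕ.≤-reflexive (count≡0 (f ∘ suc) λ _ fi → contradiction (unique₀ _ fi) λ ()))
... | false | _       = unique⇒count≤1 (f ∘ suc) (λ fi fj → suc-injective (unique fi fj))

module IntegerMatrix where

  open import Data.Integer using (ℤ; +_; -[1+_]; 0ℤ; 1ℤ; _+_; _*_; +≤+) renaming (_≤_ to _≤ℤ_)
  import Data.Integer.Properties as ℤ
  open import Data.Integer.Tactic.RingSolver using (solve-∀)
  open import Algebra.Properties.Semiring.Sum ℤ.+-*-semiring
    using (sum; sum-syntax; sum-cong-≗; sum-replicate-zero; ∑-comm; ∑-distrib-+; *-distribˡ-sum; *-distribʳ-sum)
  open ≡-Reasoning

  ⟦_⟧ : Bool → ℤ
  ⟦ true ⟧  = 1ℤ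
  ⟦ false ⟧ = 0ℤ

  ⟦∧⟧ : ∀ x y → ⟦ x ∧ y ⟧ ≡ ⟦ x ⟧ * ⟦ y ⟧
  ⟦∧⟧ true  true  = refl
  ⟦∧⟧ true  false = refl
  ⟦∧⟧ false _     = refl

  ⟦positive⟧ : ∀ {c} → c ≤ 1 → ⟦ positive c ⟧ ≡ + c
  ⟦positive⟧ z≤n       = refl
  ⟦positive⟧ (s≤s z≤n) = refl

  count-∑ : ∀ {n} (f : Fin n → Bool) → + count f ≡ ∑[ i < n ] ⟦ f i ⟧
  count-∑ {zero}  f = refl
  count-∑ {suc n} f with f zero
  ... | true  = cong (_+_ 1ℤ) (count-∑ (f ∘ suc))
  ... | false = trans (count-∑ (f ∘ suc)) (sym (ℤ.+-identityˡ _))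

  count-cong : ∀ {n} {f g : Fin n → Bool} → (∀ i → f i ≡ g i) → count f ≡ count g
  count-cong {f = f} {g} f≗g = ℤ.+-injective (begin
    + count f            ≡⟨ count-∑ f ⟩
    sum (⟦_⟧ ∘ f)        ≡⟨ sum-cong-≗ (cong ⟦_⟧ ∘ f≗g) ⟩
    sum (⟦_⟧ ∘ g)        ≡⟨ count-∑ g ⟨
    + count g            ∎)

  ∑-const : ∀ n c → ∑[ i < n ] c ≡ + n * c
  ∑-const zero    c = refl
  ∑-const (suc n) c = trans (cong (_+_ c) (∑-const n c)) (sym (ℤ.suc-* (+ n) c))

  ∑-linear : ∀ {n} (α β γ : ℤ) (a b c e : Fin n → ℤ) →
    ∑[ i < n ] (a i + α * b i + β * c i + γ * e i) ≡ sum a + α * sum b + β * sum c + γ * sum e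
  ∑-linear α β γ a b c e = begin
    ∑[ i < _ ] (a i + α * b i + β * c i + γ * e i)
      ≡⟨ ∑-distrib-+ (λ i → a i + α * b i + β * c i) _ ⟩
    ∑[ i < _ ] (a i + α * b i + β * c i) + ∑[ i < _ ] (γ * e i)
      ≡⟨ cong (λ s → s + _) (∑-distrib-+ (λ i → a i + α * b i) _) ⟩
    ∑[ i < _ ] (a i + α * b i) + ∑[ i < _ ] (β * c i) + ∑[ i < _ ] (γ * e i)
      ≡⟨ cong (λ s → s + _ + _) (∑-distrib-+ a _) ⟩
    sum a + ∑[ i < _ ] (α * b i) + ∑[ i < _ ] (β * c i) + ∑[ i < _ ] (γ * e i)
      ≡⟨ cong₂ (λ s t → sum a + s + t + _) (*-distribˡ-sum α b) (*-distribˡ-sum β c) ⟨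
    sum a + α * sum b + β * sum c + ∑[ i < _ ] (γ * e i)
      ≡⟨ cong (_+_ (sum a + α * sum b + β * sum c)) (*-distribˡ-sum γ e) ⟨
    sum a + α * sum b + β * sum c + γ * sum e ∎

  nonneg-+≡0 : ∀ {a b} → 0ℤ ≤ℤ a → 0ℤ ≤ℤ b → a + b ≡ 0ℤ → a ≡ 0ℤ × b ≡ 0ℤ
  nonneg-+≡0 {+ m} (+≤+ _) (+≤+ _) a+b≡0 =
    cong +_ (ℕ.m+n≡0⇒m≡0 m (ℤ.+-injective a+b≡0)) , cong +_ (ℕ.m+n≡0⇒n≡0 m (ℤ.+-injective a+b≡0))

  ∑-nonneg : ∀ {n} (f : Fin n → ℤ) → (∀ i → 0ℤ ≤ℤ f i) → 0ℤ ≤ℤ sum f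
  ∑-nonneg {zero}  f f≥0 = ℤ.≤-refl
  ∑-nonneg {suc n} f f≥0 = ℤ.+-mono-≤ (f≥0 zero) (∑-nonneg (f ∘ suc) (f≥0 ∘ suc))

  head+tail≡0 : ∀ {n} (f : Fin (suc n) → ℤ) → (∀ i → 0ℤ ≤ℤ f i) → sum f ≡ 0ℤ →
                f zero ≡ 0ℤ × sum (f ∘ suc) ≡ 0ℤ
  head+tail≡0 f f≥0 = nonneg-+≡0 (f≥0 zero) (∑-nonneg (f ∘ suc) (f≥0 ∘ suc))

  ∑-nonneg≡0 : ∀ {n} (f : Fin n → ℤ) → (∀ i → 0ℤ ≤ℤ f i) → sum f ≡ 0ℤ → ∀ i → f i ≡ 0ℤ
  ∑-nonneg≡0 {suc n} f f≥0 ∑f≡0 zero    = proj₁ (head+tail≡0 f f≥0 ∑f≡0)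
  ∑-nonneg≡0 {suc n} f f≥0 ∑f≡0 (suc i) = ∑-nonneg≡0 (f ∘ suc) (f≥0 ∘ suc) (proj₂ (head+tail≡0 f f≥0 ∑f≡0)) i

  square-nonneg : ∀ x → 0ℤ ≤ℤ x * x
  square-nonneg (+ n)    = subst (0ℤ ≤ℤ_) (ℤ.pos-* n n) (+≤+ z≤n)
  square-nonneg -[1+ n ] = +≤+ z≤n

  ∑-squares≡0 : ∀ {n} (f : Fin n → ℤ) → ∑[ i < n ] (f i * f i) ≡ 0ℤ → ∀ i → f i ≡ 0ℤ
  ∑-squares≡0 f ∑≡0 i =
    reduce (ℤ.i*j≡0⇒i≡0∨j≡0 (f i) (∑-nonneg≡0 (λ i → f i * f i) (square-nonneg ∘ f) ∑≡0 i))

  Matrix : ℕ → Set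
  Matrix n = Fin n → Fin n → ℤ

  infix 4 _≋_
  _≋_ : ∀ {n} → Matrix n → Matrix n → Set
  X ≋ Y = ∀ i j → X i j ≡ Y i j

  infixl 7 _·_
  _·_ : ∀ {n} → Matrix n → Matrix n → Matrix n
  _·_ {n} X Y i j = ∑[ l < n ] (X i l * Y l j)

  _ᵀ : ∀ {n} → Matrix n → Matrix n
  (X ᵀ) i j = X j i

  0ₘ : ∀ {n} → Matrix n
  0ₘ _ _ = 0ℤ

  δ : ∀ {n} → Matrix n
  δ i j = ⟦ does (i ≟ j) ⟧

  infixl 6 _+ᴵ_
  _+ᴵ_ : ∀ {n} → Matrix n → ℤ → Matrix n
  (X +ᴵ c) i j = X i j + c * δ i j

  infixr 7 _•_
  _•_ : ∀ {n} → ℤ → Matrix n → Matrix n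
  (c • X) i j = c * X i j

  rowSum : ∀ {n} → Matrix n → Fin n → ℤ
  rowSum {n} X i = ∑[ j < n ] X i j

  toMatrix : ∀ {n} → (Fin n → Fin n → Bool) → Matrix n
  toMatrix R i j = ⟦ R i j ⟧

  δ-refl : ∀ {n} (i : Fin n) → δ i i ≡ 1ℤ
  δ-refl i = cong ⟦_⟧ (dec-true (i ≟ i) refl)

  δ-≢ : ∀ {n} {i j : Fin n} → i ≢ j → δ i j ≡ 0ℤ
  δ-≢ {i = i} {j} i≢j = cong ⟦_⟧ (dec-false (i ≟ j) i≢j)

  δ-symmetric : ∀ {n} → δ {n} ᵀ ≋ δ
  δ-symmetric i j with i ≟ j
  ... | yes refl = δ-refl i
  ... | no i≢j   = δ-≢ (i≢j ∘ sym)

  ∑-δ : ∀ {n} (i : Fin n) (f : Fin n → ℤ) → ∑[ j < n ] (δ i j * f j) ≡ f i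
  ∑-δ {suc n} zero f = begin
    1ℤ * f zero + ∑[ j < n ] 0ℤ ≡⟨ cong₂ _+_ (ℤ.*-identityˡ (f zero)) (sum-replicate-zero n) ⟩
    f zero + 0ℤ                  ≡⟨ ℤ.+-identityʳ (f zero) ⟩
    f zero                       ∎
  ∑-δ (suc i) f = trans (ℤ.+-identityˡ _) (∑-δ i (f ∘ suc))

  module _ {n : ℕ} where

    ·-congˡ : ∀ (X : Matrix n) {Y Y'} → Y ≋ Y' → X · Y ≋ X · Y'
    ·-congˡ X Y≋Y' i j = sum-cong-≗ (λ l → cong (X i l *_) (Y≋Y' l j))

    ·-congʳ : ∀ (Y : Matrix n) {X X'} → X ≋ X' → X · Y ≋ X' · Y
    ·-congʳ Y X≋X' i j = sum-cong-≗ (λ l → cong (_* Y l j) (X≋X' i l))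

    δ-· : ∀ (X : Matrix n) → δ · X ≋ X
    δ-· X i j = ∑-δ i (λ l → X l j)

    ·-δ : ∀ (X : Matrix n) → X · δ ≋ X
    ·-δ X i j = trans (sum-cong-≗ λ l → trans (ℤ.*-comm (X i l) (δ l j)) (cong (_* X i l) (sym (δ-symmetric l j))))
                      (∑-δ j (X i))

    ·-assoc : ∀ (X Y Z : Matrix n) → (X · Y) · Z ≋ X · (Y · Z)
    ·-assoc X Y Z i j = begin
      ∑[ m < n ] (∑[ l < n ] (X i l * Y l m) * Z m j)
        ≡⟨ sum-cong-≗ (λ m → *-distribʳ-sum (Z m j) (λ l → X i l * Y l m)) ⟩
      ∑[ m < n ] (∑[ l < n ] (X i l * Y l m * Z m j))
        ≡⟨ ∑-comm (λ m l → X i l * Y l m * Z m j) ⟩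
      ∑[ l < n ] (∑[ m < n ] (X i l * Y l m * Z m j))
        ≡⟨ sum-cong-≗ (λ l → sum-cong-≗ λ m → ℤ.*-assoc (X i l) (Y l m) (Z m j)) ⟩
      ∑[ l < n ] (∑[ m < n ] (X i l * (Y l m * Z m j)))
        ≡⟨ sum-cong-≗ (λ l → *-distribˡ-sum (X i l) (λ m → Y l m * Z m j)) ⟨
      ∑[ l < n ] (X i l * ∑[ m < n ] (Y l m * Z m j))
        ∎

    ·-ᵀ : ∀ (X Y : Matrix n) → (X · Y) ᵀ ≋ Y ᵀ · X ᵀ
    ·-ᵀ X Y i j = sum-cong-≗ (λ l → ℤ.*-comm (X j l) (Y l i))

    rowSum-· : ∀ (X Y : Matrix n) {c} → (∀ l → rowSum Y l ≡ c) → ∀ i → rowSum (X · Y) i ≡ rowSum X i * c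
    rowSum-· X Y {c} rowY i = begin
      ∑[ j < n ] (∑[ l < n ] (X i l * Y l j))  ≡⟨ ∑-comm (λ j l → X i l * Y l j) ⟩
      ∑[ l < n ] (∑[ j < n ] (X i l * Y l j))  ≡⟨ sum-cong-≗ (λ l → *-distribˡ-sum (X i l) (Y l)) ⟨
      ∑[ l < n ] (X i l * rowSum Y l)          ≡⟨ sum-cong-≗ (λ l → cong (X i l *_) (rowY l)) ⟩
      ∑[ l < n ] (X i l * c)                   ≡⟨ *-distribʳ-sum c (X i) ⟨
      rowSum X i * c                           ∎

    ·-+ᴵ : ∀ (X Y : Matrix n) c i j → (X · (Y +ᴵ c)) i j ≡ (X · Y) i j + c * X i j
    ·-+ᴵ X Y c i j = begin
      ∑[ l < n ] (X i l * (Y l j + c * δ l j))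
        ≡⟨ sum-cong-≗ (λ l → distrib (X i l) (Y l j) c (δ l j)) ⟩
      ∑[ l < n ] (X i l * Y l j + c * (X i l * δ l j))
        ≡⟨ ∑-distrib-+ (λ l → X i l * Y l j) (λ l → c * (X i l * δ l j)) ⟩
      (X · Y) i j + ∑[ l < n ] (c * (X i l * δ l j))
        ≡⟨ cong (_+_ ((X · Y) i j)) (*-distribˡ-sum c (λ l → X i l * δ l j)) ⟨
      (X · Y) i j + c * (X · δ) i j
        ≡⟨ cong (λ s → (X · Y) i j + c * s) (·-δ X i j) ⟩
      (X · Y) i j + c * X i j
        ∎
      where
      distrib : ∀ x y c e → x * (y + c * e) ≡ x * y + c * (x * e)
      distrib = solve-∀

    +ᴵ-· : ∀ (X Y : Matrix n) c i j → ((Y +ᴵ c) · X) i j ≡ (Y · X) i j + c * X i j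
    +ᴵ-· X Y c i j = begin
      ∑[ l < n ] ((Y i l + c * δ i l) * X l j)
        ≡⟨ sum-cong-≗ (λ l → distrib (X l j) (Y i l) c (δ i l)) ⟩
      ∑[ l < n ] (Y i l * X l j + c * (δ i l * X l j))
        ≡⟨ ∑-distrib-+ (λ l → Y i l * X l j) (λ l → c * (δ i l * X l j)) ⟩
      (Y · X) i j + ∑[ l < n ] (c * (δ i l * X l j))
        ≡⟨ cong (_+_ ((Y · X) i j)) (*-distribˡ-sum c (λ l → δ i l * X l j)) ⟨
      (Y · X) i j + c * (δ · X) i j
        ≡⟨ cong (λ s → (Y · X) i j + c * s) (δ-· X i j) ⟩
      (Y · X) i j + c * X i j
        ∎
      where
      distrib : ∀ x y c e → (y + c * e) * x ≡ y * x + c * (e * x)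
      distrib = solve-∀

    rowSum-+ᴵ : ∀ (X : Matrix n) c i → rowSum (X +ᴵ c) i ≡ rowSum X i + c
    rowSum-+ᴵ X c i = begin
      ∑[ j < n ] (X i j + c * δ i j)       ≡⟨ ∑-distrib-+ (X i) (λ j → c * δ i j) ⟩
      rowSum X i + ∑[ j < n ] (c * δ i j)  ≡⟨ cong (_+_ (rowSum X i)) (sum-cong-≗ λ j → ℤ.*-comm c (δ i j)) ⟩
      rowSum X i + ∑[ j < n ] (δ i j * c)  ≡⟨ cong (_+_ (rowSum X i)) (∑-δ i (λ _ → c)) ⟩
      rowSum X i + c                       ∎

    0ₘ-· : ∀ (X : Matrix n) → 0ₘ · X ≋ 0ₘ
    0ₘ-· X i j = sum-replicate-zero n

    •-· : ∀ c (X Y : Matrix n) → (c • X) · Y ≋ c • (X · Y)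
    •-· c X Y i j = trans (sum-cong-≗ λ l → ℤ.*-assoc c (X i l) (Y l j)) (sym (*-distribˡ-sum c (λ l → X i l * Y l j)))

    toMatrix-·-ᵀ : ∀ (R : Fin n → Fin n → Bool) i j →
                   (toMatrix R · toMatrix R ᵀ) i j ≡ + count (λ l → R i l ∧ R j l)
    toMatrix-·-ᵀ R i j = sym (trans (count-∑ (λ l → R i l ∧ R j l)) (sum-cong-≗ λ l → ⟦∧⟧ (R i l) (R j l)))

module StronglyRegular where

  open import Data.Integer using (ℤ; +_; 0ℤ; 1ℤ; _+_; _*_; -_; _-_)
  import Data.Integer.Properties as ℤ
  open import Data.Integer.Tactic.RingSolver using (solve-∀)
  open import Algebra.Properties.Semiring.Sum ℤ.+-*-semiring using (sum-syntax; sum-cong-≗)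
  open IntegerMatrix
  open ≡-Reasoning

  *-distribˡ-affine : ∀ α β γ x a b e → x * (a + α * b + β * e + γ) ≡ x * a + α * (x * b) + β * (x * e) + γ * x
  *-distribˡ-affine = solve-∀

  *-distribʳ-affine : ∀ α β γ x a b e → (a + α * b + β * e + γ) * x ≡ a * x + α * (b * x) + β * (e * x) + γ * x
  *-distribʳ-affine = solve-∀

  module _ {n : ℕ} (α β γ : ℤ) where

    quadratic : Matrix n → Matrix n
    quadratic X i j = (X · X) i j + α * X i j + β * δ i j + γ

    ·-quadratic : ∀ (X Y : Matrix n) i j →
      (X · quadratic Y) i j ≡ (X · (Y · Y)) i j + α * (X · Y) i j + β * X i j + γ * rowSum X i
    ·-quadratic X Y i j = begin
      ∑[ l < n ] (X i l * quadratic Y l j)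
        ≡⟨ sum-cong-≗ (λ l → *-distribˡ-affine α β γ (X i l) ((Y · Y) l j) (Y l j) (δ l j)) ⟩
      ∑[ l < n ] (X i l * (Y · Y) l j + α * (X i l * Y l j) + β * (X i l * δ l j) + γ * X i l)
        ≡⟨ ∑-linear α β γ _ _ _ (X i) ⟩
      (X · (Y · Y)) i j + α * (X · Y) i j + β * (X · δ) i j + γ * rowSum X i
        ≡⟨ cong (λ s → (X · (Y · Y)) i j + α * (X · Y) i j + β * s + γ * rowSum X i) (·-δ X i j) ⟩
      (X · (Y · Y)) i j + α * (X · Y) i j + β * X i j + γ * rowSum X i
        ∎

    quadratic-· : ∀ (X Y : Matrix n) i j →
      (quadratic Y · X) i j ≡ ((Y · Y) · X) i j + α * (Y · X) i j + β * X i j + γ * rowSum (X ᵀ) j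
    quadratic-· X Y i j = begin
      ∑[ l < n ] (quadratic Y i l * X l j)
        ≡⟨ sum-cong-≗ (λ l → *-distribʳ-affine α β γ (X l j) ((Y · Y) i l) (Y i l) (δ i l)) ⟩
      ∑[ l < n ] ((Y · Y) i l * X l j + α * (Y i l * X l j) + β * (δ i l * X l j) + γ * X l j)
        ≡⟨ ∑-linear α β γ _ _ _ (λ l → X l j) ⟩
      ((Y · Y) · X) i j + α * (Y · X) i j + β * (δ · X) i j + γ * rowSum (X ᵀ) j
        ≡⟨ cong (λ s → ((Y · Y) · X) i j + α * (Y · X) i j + β * s + γ * rowSum (X ᵀ) j) (δ-· X i j) ⟩
      ((Y · Y) · X) i j + α * (Y · X) i j + β * X i j + γ * rowSum (X ᵀ) j
        ∎

    quadratic-intertwine : ∀ (N A B : Matrix n) {k} → N · B ≋ A · N →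
      (∀ i → rowSum N i ≡ k) → (∀ j → rowSum (N ᵀ) j ≡ k) → N · quadratic B ≋ quadratic A · N
    quadratic-intertwine N A B {k} NB≋AN rowN colN i j = begin
      (N · quadratic B) i j
        ≡⟨ ·-quadratic N B i j ⟩
      (N · (B · B)) i j + α * (N · B) i j + β * N i j + γ * rowSum N i
        ≡⟨ cong₂ (λ s t → s + α * (N · B) i j + β * N i j + γ * t) NBB≋AAN (rowN i) ⟩
      ((A · A) · N) i j + α * (N · B) i j + β * N i j + γ * k
        ≡⟨ cong₂ (λ s t → ((A · A) · N) i j + α * s + β * N i j + γ * t) (NB≋AN i j) (sym (colN j)) ⟩
      ((A · A) · N) i j + α * (A · N) i j + β * N i j + γ * rowSum (N ᵀ) j
        ≡⟨ quadratic-· N A i j ⟨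
      (quadratic A · N) i j
        ∎
      where
      NBB≋AAN : (N · (B · B)) i j ≡ ((A · A) · N) i j
      NBB≋AAN = begin
        (N · (B · B)) i j  ≡⟨ ·-assoc N B B i j ⟨
        ((N · B) · B) i j  ≡⟨ ·-congʳ B NB≋AN i j ⟩
        ((A · N) · B) i j  ≡⟨ ·-assoc A N B i j ⟩
        (A · (N · B)) i j  ≡⟨ ·-congˡ A NB≋AN i j ⟩
        (A · (A · N)) i j  ≡⟨ ·-assoc A A N i j ⟨
        ((A · A) · N) i j  ∎

    quadratic-symmetric : ∀ {X : Matrix n} → X ᵀ ≋ X → quadratic X ᵀ ≋ quadratic X
    quadratic-symmetric {X} Xᵀ≋X i j = begin
      (X · X) j i + α * X j i + β * δ j i + γ
        ≡⟨ cong₂ (λ s t → s + α * X j i + β * t + γ) (·-ᵀ X X i j) (δ-symmetric i j) ⟩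
      (X ᵀ · X ᵀ) i j + α * X j i + β * δ i j + γ
        ≡⟨ cong₂ (λ s t → s + α * t + β * δ i j + γ) XᵀXᵀ≋XX (Xᵀ≋X i j) ⟩
      (X · X) i j + α * X i j + β * δ i j + γ
        ∎
      where
      XᵀXᵀ≋XX : (X ᵀ · X ᵀ) i j ≡ (X · X) i j
      XᵀXᵀ≋XX = trans (·-congʳ (X ᵀ) Xᵀ≋X i j) (·-congˡ X Xᵀ≋X i j)

    rowSum-quadratic : ∀ {X : Matrix n} {d} → (∀ i → rowSum X i ≡ d) →
      ∀ i → rowSum (quadratic X) i ≡ d * d + α * d + β + γ * + n
    rowSum-quadratic {X} {d} rowX i = begin
      rowSum (quadratic X) i
        ≡⟨ sum-cong-≗ (λ j → cong (_+_ ((X · X) i j + α * X i j + β * δ i j)) (sym (ℤ.*-identityʳ γ))) ⟩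
      ∑[ j < n ] ((X · X) i j + α * X i j + β * δ i j + γ * 1ℤ)
        ≡⟨ ∑-linear α β γ _ (X i) (δ i) (λ _ → 1ℤ) ⟩
      rowSum (X · X) i + α * rowSum X i + β * rowSum δ i + γ * ∑[ j < n ] 1ℤ
        ≡⟨ cong₂ (λ s t → s + α * t + β * rowSum δ i + γ * ∑[ j < n ] 1ℤ) (rowSum-· X X rowX i) (rowX i) ⟩
      rowSum X i * d + α * d + β * rowSum δ i + γ * ∑[ j < n ] 1ℤ
        ≡⟨ cong₂ (λ s t → s * d + α * d + β * t + γ * ∑[ j < n ] 1ℤ) (rowX i) rowSum-δ ⟩
      d * d + α * d + β * 1ℤ + γ * ∑[ j < n ] 1ℤ
        ≡⟨ cong₂ (λ s t → d * d + α * d + s + γ * t) (ℤ.*-identityʳ β) (trans (∑-const n 1ℤ) (ℤ.*-identityʳ (+ n))) ⟩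
      d * d + α * d + β + γ * + n
        ∎
      where
      rowSum-δ : rowSum δ i ≡ 1ℤ
      rowSum-δ = trans (sum-cong-≗ λ j → sym (ℤ.*-identityʳ (δ i j))) (∑-δ i (λ _ → 1ℤ))

  record IsRegularGraph (n : ℕ) (R : Fin n → Fin n → Bool) (d : ℕ) : Set where
    field
      irrefl    : ∀ x → R x x ≡ false
      symmetric : ∀ x y → R x y ≡ R y x
      regular   : ∀ x → count (R x) ≡ d

  isSRG⇒isRegularGraph : ∀ {n R d lam mu} → IsSRG n R d lam mu → IsRegularGraph n R d
  isSRG⇒isRegularGraph srg = record { irrefl = irrefl ; symmetric = symmetric ; regular = regular }
    where open IsSRG srg

  common-neighbours : ∀ {n} {R : Fin n → Fin n → Bool} → (∀ x y → R x y ≡ R y x) →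
    ∀ x y → (toMatrix R · toMatrix R) x y ≡ + count (λ z → R x z ∧ R y z)
  common-neighbours {R = R} R-sym x y =
    trans (·-congˡ (toMatrix R) (λ z y → cong ⟦_⟧ (R-sym z y)) x y) (toMatrix-·-ᵀ R x y)

  module SRG (d lam mu : ℕ) where

    -- residual X = X² − (λ X + μ (J − I − X) + d I), expanded.

    α β γ : ℤ
    α = + mu - + lam
    β = + mu - + d
    γ = - + mu

    residual : ∀ {n} → Matrix n → Matrix n
    residual = quadratic α β γ

    module _ {n : ℕ} {R : Fin n → Fin n → Bool} where

      residual-at : (∀ x y → R x y ≡ R y x) → ∀ {x y c a e} →
        count (λ z → R x z ∧ R y z) ≡ c → R x y ≡ a → δ x y ≡ e →
        residual (toMatrix R) x y ≡ + c + α * ⟦ a ⟧ + β * e + γ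
      residual-at R-sym {x} {y} refl refl refl =
        cong (λ s → s + α * ⟦ R x y ⟧ + β * δ x y + γ) (common-neighbours R-sym x y)

      residual-diagonal : IsRegularGraph n R d → ∀ x → residual (toMatrix R) x x ≡ 0ℤ
      residual-diagonal G x = trans (residual-at symmetric degree (irrefl x) (δ-refl x)) (vanishes (+ d) (+ lam) (+ mu))
        where
        open IsRegularGraph G
        degree : count (λ z → R x z ∧ R x z) ≡ d
        degree = trans (count-cong (λ z → Bool.∧-idem (R x z))) (regular x)
        vanishes : ∀ d l m → d + (m - l) * 0ℤ + (m - d) * 1ℤ + - m ≡ 0ℤ
        vanishes = solve-∀

      isSRG⇒residual≡0 : IsSRG n R d lam mu → residual (toMatrix R) ≋ 0ₘ
      isSRG⇒residual≡0 srg x y = entry (x ≟ y) (R x y) refl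
        where
        open IsSRG srg
        entry : Dec (x ≡ y) → ∀ a → R x y ≡ a → residual (toMatrix R) x y ≡ 0ℤ
        entry (yes refl) _ _ = residual-diagonal (isSRG⇒isRegularGraph srg) x
        entry (no x≢y) true Rxy =
          trans (residual-at symmetric (adjacent x y Rxy) Rxy (δ-≢ x≢y)) (vanishes (+ d) (+ lam) (+ mu))
          where
          vanishes : ∀ d l m → l + (m - l) * 1ℤ + (m - d) * 0ℤ + - m ≡ 0ℤ
          vanishes = solve-∀
        entry (no x≢y) false Rxy =
          trans (residual-at symmetric (nonadj x y x≢y Rxy) Rxy (δ-≢ x≢y)) (vanishes (+ d) (+ lam) (+ mu))
          where
          vanishes : ∀ d l m → m + (m - l) * 0ℤ + (m - d) * 0ℤ + - m ≡ 0ℤ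
          vanishes = solve-∀

      residual≡0⇒isSRG : IsRegularGraph n R d → residual (toMatrix R) ≋ 0ₘ → IsSRG n R d lam mu
      residual≡0⇒isSRG G residual≡0 = record
        { irrefl    = irrefl
        ; symmetric = symmetric
        ; regular   = regular
        ; adjacent  = adjacent
        ; nonadj    = nonadjacent
        }
        where
        open IsRegularGraph G

        entry-vanishes : ∀ {x y a e} → R x y ≡ a → δ x y ≡ e →
          + count (λ z → R x z ∧ R y z) + α * ⟦ a ⟧ + β * e + γ ≡ 0ℤ
        entry-vanishes {x} {y} Rxy δxy = trans (sym (residual-at symmetric refl Rxy δxy)) (residual≡0 x y)

        adjacent : ∀ x y → R x y ≡ true → count (λ z → R x z ∧ R y z) ≡ lam
        adjacent x y Rxy = ℤ.+-injective (begin
          c                                        ≡⟨ isolate c (+ d) (+ lam) (+ mu) ⟩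
          (c + α * 1ℤ + β * 0ℤ + γ) + + lam         ≡⟨ cong (λ s → s + + lam) (entry-vanishes Rxy (δ-≢ x≢y)) ⟩
          0ℤ + + lam                                ≡⟨ ℤ.+-identityˡ (+ lam) ⟩
          + lam                                     ∎)
          where
          c : ℤ
          c = + count (λ z → R x z ∧ R y z)
          x≢y : x ≢ y
          x≢y refl = contradiction (trans (sym Rxy) (irrefl x)) λ ()
          isolate : ∀ c d l m → c ≡ (c + (m - l) * 1ℤ + (m - d) * 0ℤ + - m) + l
          isolate = solve-∀

        nonadjacent : ∀ x y → x ≢ y → R x y ≡ false → count (λ z → R x z ∧ R y z) ≡ mu
        nonadjacent x y x≢y Rxy = ℤ.+-injective (begin
          c                                        ≡⟨ isolate c (+ d) (+ lam) (+ mu) ⟩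
          (c + α * 0ℤ + β * 0ℤ + γ) + + mu          ≡⟨ cong (λ s → s + + mu) (entry-vanishes Rxy (δ-≢ x≢y)) ⟩
          0ℤ + + mu                                 ≡⟨ ℤ.+-identityˡ (+ mu) ⟩
          + mu                                      ∎)
          where
          c : ℤ
          c = + count (λ z → R x z ∧ R y z)
          isolate : ∀ c d l m → c ≡ (c + (m - l) * 0ℤ + (m - d) * 0ℤ + - m) + m
          isolate = solve-∀

module Configuration where

  open import Data.Integer using (+_; 0ℤ; 1ℤ; _+_; _*_)
  import Data.Integer.Properties as ℤ
  open import Function.Bundles using (Equivalence)
  open Equivalence
  open IntegerMatrix
  open ≡-Reasoning

  module _ {v k : ℕ} (S : SymConfig v k) where

    open SymConfig S

    lines-meet-at-most-once : ∀ L M → L ≢ M → count (λ p → I p L ∧ I p M) ≤ 1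
    lines-meet-at-most-once L M L≢M = unique⇒count≤1 (λ p → I p L ∧ I p M) common-point-unique
      where
      common-point-unique : ∀ {p q} → T (I p L ∧ I p M) → T (I q L ∧ I q M) → p ≡ q
      common-point-unique {p} {q} pLM qLM with p ≟ q
      ... | yes p≡q = p≡q
      ... | no p≢q  = contradiction (count≤1⇒unique (λ N → I p N ∧ I q N) (at-most-one p q p≢q) pqL pqM) L≢M
        where
        pqL : T (I p L ∧ I q L)
        pqL = from Bool.T-∧ (proj₁ (to (Bool.T-∧ {I p L}) pLM) , proj₁ (to (Bool.T-∧ {I q L}) qLM))
        pqM : T (I p M ∧ I q M)
        pqM = from Bool.T-∧ (proj₂ (to (Bool.T-∧ {I p L}) pLM) , proj₂ (to (Bool.T-∧ {I q L}) qLM))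

    dual : SymConfig v k
    dual = record
      { I            = λ L p → I p L
      ; line-size    = point-degree
      ; point-degree = line-size
      ; at-most-one  = lines-meet-at-most-once
      }

    lineAdj≡pointAdj-dual : ∀ L M → lineAdj S L M ≡ pointAdj dual L M
    lineAdj≡pointAdj-dual L M with L ≟ M
    ... | yes _ = refl
    ... | no _  = refl

    pointAdj-irrefl : ∀ p → pointAdj S p p ≡ false
    pointAdj-irrefl p with p ≟ p
    ... | yes _   = refl
    ... | no p≢p  = contradiction refl p≢p

    pointAdj-symmetric : ∀ p q → pointAdj S p q ≡ pointAdj S q p
    pointAdj-symmetric p q with p ≟ q | q ≟ p
    ... | yes _   | yes _   = refl
    ... | yes p≡q | no q≢p  = contradiction (sym p≡q) q≢p
    ... | no p≢q  | yes q≡p = contradiction (sym q≡p) p≢q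
    ... | no _    | no _    = cong positive (count-cong λ L → Bool.∧-comm (I p L) (I q L))

    pointAdj-≢ : ∀ {p q} → p ≢ q → pointAdj S p q ≡ positive (count (λ L → I p L ∧ I q L))
    pointAdj-≢ {p} {q} p≢q with p ≟ q
    ... | yes p≡q = contradiction p≡q p≢q
    ... | no _    = refl

    incidence : Matrix v
    incidence = toMatrix I

    incidence-·-ᵀ : incidence · incidence ᵀ ≋ toMatrix (pointAdj S) +ᴵ + k
    incidence-·-ᵀ p q = trans (toMatrix-·-ᵀ I p q) (entry (p ≟ q))
      where
      entry : Dec (p ≡ q) → + count (λ L → I p L ∧ I q L) ≡ ⟦ pointAdj S p q ⟧ + + k * δ p q
      entry (yes refl) = begin
        + count (λ L → I p L ∧ I p L)   ≡⟨ cong +_ (count-cong λ L → Bool.∧-idem (I p L)) ⟩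
        + count (I p)                   ≡⟨ cong +_ (point-degree p) ⟩
        + k                             ≡⟨ ℤ.*-identityʳ (+ k) ⟨
        + k * 1ℤ                        ≡⟨ ℤ.+-identityˡ (+ k * 1ℤ) ⟨
        0ℤ + + k * 1ℤ                   ≡⟨ cong₂ (λ a e → ⟦ a ⟧ + + k * e) (pointAdj-irrefl p) (δ-refl p) ⟨
        ⟦ pointAdj S p p ⟧ + + k * δ p p ∎
      entry (no p≢q) = begin
        + c                                ≡⟨ ⟦positive⟧ (at-most-one p q p≢q) ⟨
        ⟦ positive c ⟧                     ≡⟨ cong ⟦_⟧ (pointAdj-≢ p≢q) ⟨
        ⟦ pointAdj S p q ⟧                 ≡⟨ ℤ.+-identityʳ _ ⟨
        ⟦ pointAdj S p q ⟧ + 0ℤ            ≡⟨ cong (λ e → ⟦ pointAdj S p q ⟧ + e) (ℤ.*-zeroʳ (+ k)) ⟨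
        ⟦ pointAdj S p q ⟧ + + k * 0ℤ      ≡⟨ cong (λ e → ⟦ pointAdj S p q ⟧ + + k * e) (δ-≢ p≢q) ⟨
        ⟦ pointAdj S p q ⟧ + + k * δ p q   ∎
        where
        c : ℕ
        c = count (λ L → I p L ∧ I q L)

    rowSum-incidence : ∀ p → rowSum incidence p ≡ + k
    rowSum-incidence p = trans (sym (count-∑ (I p))) (cong +_ (point-degree p))

    rowSum-incidenceᵀ : ∀ L → rowSum (incidence ᵀ) L ≡ + k
    rowSum-incidenceᵀ L = trans (sym (count-∑ (λ p → I p L))) (cong +_ (line-size L))

    rowSum-incidence-·-ᵀ : ∀ p → rowSum (incidence · incidence ᵀ) p ≡ + k * + k
    rowSum-incidence-·-ᵀ p = trans (rowSum-· incidence (incidence ᵀ) rowSum-incidenceᵀ p) (cong (_* + k) (rowSum-incidence p))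

module LineGraph {v k d lam mu : ℕ} (S : SymConfig v k) (H : IsSRG v (pointAdj S) d lam mu) where

  open import Data.Integer using (+_; 0ℤ; _+_; _*_; -_)
  import Data.Integer.Properties as ℤ
  open import Data.Integer.Tactic.RingSolver using (solve-∀)
  open import Algebra.Properties.AbelianGroup ℤ.+-0-abelianGroup using (∙-cancelʳ)
  open import Algebra.Properties.Semiring.Sum ℤ.+-*-semiring using (sum-cong-≗; sum-replicate-zero)
  open IntegerMatrix
  open StronglyRegular
  open SRG d lam mu
  open Configuration
  open ≡-Reasoning

  N A B E : Matrix v
  N = incidence S
  A = toMatrix (pointAdj S)
  B = toMatrix (lineAdj S)
  E = residual B

  Nᵀ·N≋B+k : N ᵀ · N ≋ B +ᴵ + k
  Nᵀ·N≋B+k L M = trans (incidence-·-ᵀ (dual S) L M)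
                       (cong (λ a → ⟦ a ⟧ + + k * δ L M) (sym (lineAdj≡pointAdj-dual S L M)))

  pointGraph-rowSum : ∀ p → rowSum A p ≡ + d
  pointGraph-rowSum p = trans (sym (count-∑ (pointAdj S p))) (cong +_ (IsSRG.regular H p))

  lineGraph-rowSum : ∀ L → rowSum B L ≡ + d
  lineGraph-rowSum L = ∙-cancelʳ (+ k) (rowSum B L) (+ d) (begin
    rowSum B L + + k       ≡⟨ rowSum-+ᴵ B (+ k) L ⟨
    rowSum (B +ᴵ + k) L    ≡⟨ sum-cong-≗ (Nᵀ·N≋B+k L) ⟨
    rowSum (N ᵀ · N) L     ≡⟨ rowSum-incidence-·-ᵀ (dual S) L ⟩
    + k * + k              ≡⟨ rowSum-incidence-·-ᵀ S L ⟨
    rowSum (N · N ᵀ) L     ≡⟨ sum-cong-≗ (incidence-·-ᵀ S L) ⟩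
    rowSum (A +ᴵ + k) L    ≡⟨ rowSum-+ᴵ A (+ k) L ⟩
    rowSum A L + + k       ≡⟨ cong (λ s → s + + k) (pointGraph-rowSum L) ⟩
    + d + + k              ∎)

  lineGraph-isRegular : IsRegularGraph v (lineAdj S) d
  lineGraph-isRegular = record
    { irrefl    = λ L → trans (lineAdj≡pointAdj-dual S L L) (pointAdj-irrefl (dual S) L)
    ; symmetric = λ L M → begin
        lineAdj S L M          ≡⟨ lineAdj≡pointAdj-dual S L M ⟩
        pointAdj (dual S) L M  ≡⟨ pointAdj-symmetric (dual S) L M ⟩
        pointAdj (dual S) M L  ≡⟨ lineAdj≡pointAdj-dual S M L ⟨
        lineAdj S M L          ∎
    ; regular   = λ L → ℤ.+-injective (trans (count-∑ (lineAdj S L)) (lineGraph-rowSum L))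
    }

  N·B≋A·N : N · B ≋ A · N
  N·B≋A·N p L = ∙-cancelʳ (+ k * N p L) ((N · B) p L) ((A · N) p L) (begin
    (N · B) p L + + k * N p L   ≡⟨ ·-+ᴵ N B (+ k) p L ⟨
    (N · (B +ᴵ + k)) p L        ≡⟨ ·-congˡ N Nᵀ·N≋B+k p L ⟨
    (N · (N ᵀ · N)) p L         ≡⟨ ·-assoc N (N ᵀ) N p L ⟨
    ((N · N ᵀ) · N) p L         ≡⟨ ·-congʳ N (incidence-·-ᵀ S) p L ⟩
    ((A +ᴵ + k) · N) p L        ≡⟨ +ᴵ-· N A (+ k) p L ⟩
    (A · N) p L + + k * N p L   ∎)

  N·E≋0 : N · E ≋ 0ₘ
  N·E≋0 p L = begin
    (N · E) p L           ≡⟨ quadratic-intertwine α β γ N A B N·B≋A·N (rowSum-incidence S) (rowSum-incidenceᵀ S) p L ⟩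
    (residual A · N) p L  ≡⟨ ·-congʳ N (isSRG⇒residual≡0 H) p L ⟩
    (0ₘ · N) p L          ≡⟨ 0ₘ-· N p L ⟩
    0ℤ                    ∎

  E-symmetric : E ᵀ ≋ E
  E-symmetric = quadratic-symmetric α β γ (λ L M → cong ⟦_⟧ (IsRegularGraph.symmetric lineGraph-isRegular M L))

  E·Nᵀ≋0 : E · N ᵀ ≋ 0ₘ
  E·Nᵀ≋0 L p = begin
    (E · N ᵀ) L p     ≡⟨ ·-congʳ (N ᵀ) E-symmetric L p ⟨
    (E ᵀ · N ᵀ) L p   ≡⟨ ·-ᵀ N E L p ⟨
    (N · E) p L       ≡⟨ N·E≋0 p L ⟩
    0ℤ                ∎

  E·B≋-k•E : E · B ≋ (- + k) • E
  E·B≋-k•E L M = begin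
    (E · B) L M                                  ≡⟨ isolate ((E · B) L M) (+ k) (E L M) ⟩
    ((E · B) L M + + k * E L M) + - + k * E L M  ≡⟨ cong (λ s → s + - + k * E L M) E·[B+k]≡0 ⟩
    0ℤ + - + k * E L M                           ≡⟨ ℤ.+-identityˡ _ ⟩
    - + k * E L M                                ∎
    where
    isolate : ∀ x k e → x ≡ (x + k * e) + - k * e
    isolate = solve-∀
    E·[B+k]≡0 : (E · B) L M + + k * E L M ≡ 0ℤ
    E·[B+k]≡0 = begin
      (E · B) L M + + k * E L M  ≡⟨ ·-+ᴵ E B (+ k) L M ⟨
      (E · (B +ᴵ + k)) L M       ≡⟨ ·-congˡ E Nᵀ·N≋B+k L M ⟨
      (E · (N ᵀ · N)) L M        ≡⟨ ·-assoc E (N ᵀ) N L M ⟨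
      ((E · N ᵀ) · N) L M        ≡⟨ ·-congʳ N E·Nᵀ≋0 L M ⟩
      (0ₘ · N) L M               ≡⟨ 0ₘ-· N L M ⟩
      0ℤ                         ∎

  E-rowSum : ∀ L → rowSum E L ≡ 0ℤ
  E-rowSum L = begin
    rowSum E L                            ≡⟨ rowSum-quadratic α β γ lineGraph-rowSum L ⟩
    + d * + d + α * + d + β + γ * + v     ≡⟨ rowSum-quadratic α β γ pointGraph-rowSum L ⟨
    rowSum (residual A) L                 ≡⟨ sum-cong-≗ (isSRG⇒residual≡0 H L) ⟩
    rowSum 0ₘ L                           ≡⟨ sum-replicate-zero v ⟩
    0ℤ                                    ∎

  E·B-diagonal : ∀ L → (E · B) L L ≡ 0ℤ
  E·B-diagonal L = begin
    (E · B) L L    ≡⟨ E·B≋-k•E L L ⟩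
    - + k * E L L  ≡⟨ cong (- + k *_) (residual-diagonal lineGraph-isRegular L) ⟩
    - + k * 0ℤ     ≡⟨ ℤ.*-zeroʳ (- + k) ⟩
    0ℤ             ∎

  E·E-diagonal : ∀ L → (E · E) L L ≡ 0ℤ
  E·E-diagonal L = begin
    (E · E) L L
      ≡⟨ ·-quadratic α β γ E B L L ⟩
    (E · (B · B)) L L + α * (E · B) L L + β * E L L + γ * rowSum E L
      ≡⟨ cong (λ s → s + α * (E · B) L L + β * E L L + γ * rowSum E L) E·BB-diagonal ⟩
    0ℤ + α * (E · B) L L + β * E L L + γ * rowSum E L
      ≡⟨ cong₂ (λ s t → 0ℤ + α * s + β * t + γ * rowSum E L) (E·B-diagonal L) (residual-diagonal lineGraph-isRegular L) ⟩
    0ℤ + α * 0ℤ + β * 0ℤ + γ * rowSum E L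
      ≡⟨ cong (λ s → 0ℤ + α * 0ℤ + β * 0ℤ + γ * s) (E-rowSum L) ⟩
    0ℤ + α * 0ℤ + β * 0ℤ + γ * 0ℤ
      ≡⟨ vanishes α β γ ⟩
    0ℤ ∎
    where
    vanishes : ∀ α β γ → 0ℤ + α * 0ℤ + β * 0ℤ + γ * 0ℤ ≡ 0ℤ
    vanishes = solve-∀
    E·BB-diagonal : (E · (B · B)) L L ≡ 0ℤ
    E·BB-diagonal = begin
      (E · (B · B)) L L       ≡⟨ ·-assoc E B B L L ⟨
      ((E · B) · B) L L       ≡⟨ ·-congʳ B E·B≋-k•E L L ⟩
      (((- + k) • E) · B) L L ≡⟨ •-· (- + k) E B L L ⟩
      - + k * (E · B) L L     ≡⟨ cong (- + k *_) (E·B-diagonal L) ⟩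
      - + k * 0ℤ              ≡⟨ ℤ.*-zeroʳ (- + k) ⟩
      0ℤ                      ∎

  E≋0 : E ≋ 0ₘ
  E≋0 L = ∑-squares≡0 (E L) (trans (sum-cong-≗ λ z → cong (E L z *_) (sym (E-symmetric L z))) (E·E-diagonal L))

  lineGraph-isSRG : IsSRG v (lineAdj S) d lam mu
  lineGraph-isSRG = residual≡0⇒isSRG lineGraph-isRegular E≋0

open import Data.Nat using (_*_; _∸_)

theorem4 : (v k lam mu : ℕ) → 3 ≤ k → (S : SymConfig v k) →
    IsSRG v (pointAdj S) (k * (k ∸ 1)) lam mu →
    IsSRG v (lineAdj S) (k * (k ∸ 1)) lam mu
theorem4 v k lam mu _ S H = LineGraph.lineGraph-isSRG S H
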